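{- Writing $A_k(x;z)=\sum_{i=1}^{2k}a_{k,i}(z)x^i$, the coefficients satisfy $a_{k,i}(z)=i(i+z)a_{k-1,i}(z)+[2i(3k-i-1)-(1-z)(3k-2i)]a_{k-1,i-1}(z)+(3k-i)(3k-i-z)a_{k-1,i-2}(z)$, with $a_{0,i}(z)=\delta_{0,i}$. Thus, when $-1<z<1$, the coefficients $a_{k,i}(z)$ are nonnegative for $k\geq1$ and $1\leq i\leq 2k$.
   Context: The Jacobi-Stirling numbers of the second kind $\mathrm{JS}(n,k;z)$ ($n\geq k\geq0$) are defined by $\mathrm{JS}(n,k;z)=\mathrm{JS}(n-1,k-1;z)+k(k+z)\mathrm{JS}(n-1,k;z)$ with $\mathrm{JS}(0,0;z)=1$ and $\mathrm{JS}(j,0;z)=\mathrm{JS}(0,j;z)=0$ for $j\geq1$. For $k\geq0$, $F_k(x;z)=\sum_{n\geq0}\mathrm{JS}(k+n,n;z)x^n$, and for real $z\neq1$ one has $F_k(x;z)=A_k(x;z)/(1-x)^{3k+1}$ where $A_k(x;z)$ is a polynomial in $x$ of degree $2k$ with $A_k(0;z)=0$ for $k\geq1$ and $A_0=1$.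
   Formalization: The parameter z ranges over the rationals instead of the reals, both in the recurrence and in the nonnegativity claim. -}

module Defs where

open import Data.Nat using (ℕ; zero; suc; _∸_) renaming (_+_ to _+ℕ_; _*_ to _*ℕ_)
open import Data.Nat.Combinatorics using (_C_)
open import Data.Integer using (+_)
open import Data.Rational using (ℚ; 0ℚ; 1ℚ; _+_; _*_; _-_; -_; _/_)
open import Data.List using (List; upTo; foldr; map)

ℕ→ℚ : ℕ → ℚ
ℕ→ℚ n = + n / 1

sumℚ : List ℚ → ℚ
sumℚ = foldr _+_ 0ℚ

sign : ℕ → ℚ
sign zero = 1ℚ
sign (suc j) = - sign j

JS : ℕ → ℕ → ℚ → ℚ
JS zero zero z = 1ℚ
JS zero (suc k) z = 0ℚ
JS (suc n) zero z = 0ℚ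
JS (suc n) (suc k) z = JS n k z + (ℕ→ℚ (suc k) * (ℕ→ℚ (suc k) + z)) * JS n (suc k) z

-- a_{k,i}(z) : coefficient of x^i in A_k(x;z) = (1-x)^{3k+1} F_k(x;z),
-- where F_k(x;z) = Σ_{n≥0} JS(k+n,n;z) x^n (formal power series product):
-- a_{k,i}(z) = Σ_{j=0}^{i} (-1)^j C(3k+1,j) JS(k+i-j, i-j; z).
a : ℕ → ℕ → ℚ → ℚ
a k i z = sumℚ (map (λ j → (sign j * ℕ→ℚ ((3 *ℕ k +ℕ 1) C j)) * JS (k +ℕ (i ∸ j)) (i ∸ j) z)
                    (upTo (suc i)))

-- aShift k i d z = a_{k,i-d}(z), with the convention a_{k,m} = 0 for m < 0.
aShift : ℕ → ℕ → ℕ → ℚ → ℚ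
aShift k i zero z = a k i z
aShift k zero (suc d) z = 0ℚ
aShift k (suc i) (suc d) z = aShift k i d z

δ0 : ℕ → ℚ
δ0 zero = 1ℚ
δ0 (suc i) = 0ℚ

{-# OPTIONS --safe #-}
-- Let f_k n = JS(k+n, n; z) be the coefficients of F_k, and let shift and Δ = 1 - shift act
-- on sequences as multiplication of generating functions by x and by 1 - x; then
-- a_k = Δ^(3k+1) f_k, and the recurrence of JS says Δ f_{k+1} = n(n+z) f_k.  Write T_Q for
-- the three-term operator of the statement (threeTermSeq Q z).  A direct computation gives
-- Δ T_Q = T_{Q+1} Δ and T_0 = n(n+z) Δ², hence Δ^(2+m) (n(n+z) g) = T_{2+m} (Δ^m g), as one
-- sees by applying both sides to a double prefix sum of g.  With m = 3k+1 this is
-- a_{k+1} = T_{3k+3} a_k.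
-- For -1 < z < 1 and 1 ≤ n < Q, substituting n = 1+J and Q = 2+J+R with J, R ≥ 0 makes the
-- three coefficients of T_Q manifestly nonnegative.  As a_k vanishes beyond 2k, T_{3k+3} a_k is
-- then nonnegative everywhere, and induction on k gives a_{k,i} ≥ 0.
module Submission where

open import Defs
open import Data.Nat using (ℕ; suc) renaming (_*_ to _*ℕ_; _≤_ to _≤ℕ_)
open import Data.Product using (_×_)
open import Relation.Binary.PropositionalEquality using (_≡_; _≢_)
open import Data.Rational using (ℚ; 0ℚ; 1ℚ; _+_; _*_; _-_; -_; _≤_; _<_)

open import Data.Nat as ℕ using (zero; _∸_; s≤s) renaming (_+_ to _+ℕ_)
import Data.Nat.Properties as ℕ
open import Data.Nat.Combinatorics using (_C_; nCk+nC[k+1]≡[n+1]C[k+1])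
open import Data.Nat.Tactic.RingSolver using (solve-∀)
open import Data.Nat.Coprimality using (1-coprimeTo) renaming (sym to coprime-sym)
open import Data.Rational using (mkℚ; _/_; nonNegative)
import Data.Rational.Properties as ℚ
open import Data.Rational.Solver using (module +-*-Solver)
open import Data.List using (applyUpTo; map)
open import Data.Product using (_,_; proj₁; proj₂)
open import Function using (_∘_)
open import Relation.Nullary using (yes; no)
open import Relation.Binary.PropositionalEquality
  using (refl; sym; trans; cong; cong₂; subst; subst₂; _≗_; module ≡-Reasoning)

open +-*-Solver using (Polynomial; con; _:+_; _:*_; _:-_; _:=_; solve)
open ≡-Reasoning

ℕ→ℚ-+ : ∀ m n → ℕ→ℚ (m +ℕ n) ≡ ℕ→ℚ m + ℕ→ℚ n
ℕ→ℚ-+ m n = sym (trans (cong₂ _+_ (ℕ→ℚ-mkℚ m) (ℕ→ℚ-mkℚ n))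
  (cong₂ (λ p q → (p ℤ.+ q) / 1) (*-identityʳ (ℤ.+ m)) (*-identityʳ (ℤ.+ n))))
  where
  import Data.Integer as ℤ
  open import Data.Integer.Properties using (*-identityʳ)
  ℕ→ℚ-mkℚ : ∀ n → ℕ→ℚ n ≡ mkℚ (ℤ.+ n) 0 (coprime-sym (1-coprimeTo n))
  ℕ→ℚ-mkℚ n = ℚ.normalize-coprime (coprime-sym (1-coprimeTo n))

ℕ→ℚ-suc : ∀ n → ℕ→ℚ (suc n) ≡ 1ℚ + ℕ→ℚ n
ℕ→ℚ-suc = ℕ→ℚ-+ 1

Seq : Set
Seq = ℕ → ℚ

shift : Seq → Seq
shift g zero    = 0ℚ
shift g (suc n) = g n

Δ : Seq → Seq
Δ g n = g n - shift g n

Δ^ : ℕ → Seq → Seq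
Δ^ zero    g = g
Δ^ (suc N) g = Δ^ N (Δ g)

shift-cong : ∀ {f g} → f ≗ g → shift f ≗ shift g
shift-cong f≗g zero    = refl
shift-cong f≗g (suc n) = f≗g n

Δ-cong : ∀ {f g} → f ≗ g → Δ f ≗ Δ g
Δ-cong f≗g n = cong₂ _-_ (f≗g n) (shift-cong f≗g n)

Δ^-cong : ∀ N {f g} → f ≗ g → Δ^ N f ≗ Δ^ N g
Δ^-cong zero    f≗g = f≗g
Δ^-cong (suc N) f≗g = Δ^-cong N (Δ-cong f≗g)

Δ^-Δ : ∀ N g → Δ^ N (Δ g) ≗ Δ (Δ^ N g)
Δ^-Δ zero    g n = refl
Δ^-Δ (suc N) g   = Δ^-Δ N (Δ g)

shift-Δ : ∀ g → shift (Δ g) ≗ Δ (shift g)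
shift-Δ g zero    = refl
shift-Δ g (suc n) = refl

prefixSum : Seq → Seq
prefixSum g zero    = g zero
prefixSum g (suc n) = prefixSum g n + g (suc n)

Δ-prefixSum : ∀ g → Δ (prefixSum g) ≗ g
Δ-prefixSum g zero    = ℚ.+-identityʳ (g zero)
Δ-prefixSum g (suc n) = solve 2 (λ s x → (s :+ x) :- s := x) refl (prefixSum g n) (g (suc n))

∑< : ℕ → Seq → ℚ
∑< zero    f = 0ℚ
∑< (suc n) f = f zero + ∑< n (f ∘ suc)

sumℚ-map-applyUpTo : ∀ n (h : Seq) (f : ℕ → ℕ) → sumℚ (map h (applyUpTo f n)) ≡ ∑< n (h ∘ f)
sumℚ-map-applyUpTo zero    h f = refl
sumℚ-map-applyUpTo (suc n) h f = cong (h (f zero) +_) (sumℚ-map-applyUpTo n h (f ∘ suc))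

∑<-cong : ∀ n {f g} → f ≗ g → ∑< n f ≡ ∑< n g
∑<-cong zero    f≗g = refl
∑<-cong (suc n) f≗g = cong₂ _+_ (f≗g zero) (∑<-cong n (f≗g ∘ suc))

∑<-zero : ∀ n {f} → (∀ j → f j ≡ 0ℚ) → ∑< n f ≡ 0ℚ
∑<-zero zero    f≡0 = refl
∑<-zero (suc n) f≡0 = cong₂ _+_ (f≡0 zero) (∑<-zero n (f≡0 ∘ suc))

∑<-sub : ∀ n f g → ∑< n (λ j → f j - g j) ≡ ∑< n f - ∑< n g
∑<-sub zero    f g = refl
∑<-sub (suc n) f g = begin
  (f zero - g zero) + ∑< n (λ j → f (suc j) - g (suc j))
    ≡⟨ cong ((f zero - g zero) +_) (∑<-sub n (f ∘ suc) (g ∘ suc)) ⟩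
  (f zero - g zero) + (∑< n (f ∘ suc) - ∑< n (g ∘ suc))
    ≡⟨ solve 4 (λ a b c d → (a :- b) :+ (c :- d) := (a :+ c) :- (b :+ d)) refl
         (f zero) (g zero) (∑< n (f ∘ suc)) (∑< n (g ∘ suc)) ⟩
  (f zero + ∑< n (f ∘ suc)) - (g zero + ∑< n (g ∘ suc)) ∎

-- The coefficient sequence of (1 - x)^N · Σₙ g n xⁿ.
binomialDifference : ℕ → Seq → Seq
binomialDifference N g i = ∑< (suc i) (λ j → (sign j * ℕ→ℚ (N C j)) * g (i ∸ j))

binomialDifference-zero : ∀ g → binomialDifference 0 g ≗ g
binomialDifference-zero g i = begin
  1ℚ * g i + ∑< i term  ≡⟨ cong (1ℚ * g i +_) (∑<-zero i term≡0) ⟩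
  1ℚ * g i + 0ℚ         ≡⟨ trans (ℚ.+-identityʳ _) (ℚ.*-identityˡ _) ⟩
  g i                   ∎
  where
  term : Seq
  term j = (- sign j * 0ℚ) * g (i ∸ suc j)
  term≡0 : ∀ j → term j ≡ 0ℚ
  term≡0 j = trans (cong (_* g (i ∸ suc j)) (ℚ.*-zeroʳ (- sign j))) (ℚ.*-zeroˡ (g (i ∸ suc j)))

binomialDifference-suc : ∀ N g → binomialDifference (suc N) g ≗ Δ (binomialDifference N g)
binomialDifference-suc N g zero    = sym (ℚ.+-identityʳ _)
binomialDifference-suc N g (suc i) = begin
  T zero + ∑< (suc i) (T ∘ suc)
    ≡⟨ cong (T zero +_) (∑<-cong (suc i) pascal) ⟩
  T zero + ∑< (suc i) (λ j → U (suc j) - W j)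
    ≡⟨ cong (T zero +_) (∑<-sub (suc i) (U ∘ suc) W) ⟩
  T zero + (∑< (suc i) (U ∘ suc) - ∑< (suc i) W)
    ≡⟨ sym (ℚ.+-assoc (T zero) _ _) ⟩
  binomialDifference N g (suc i) - binomialDifference N g i ∎
  where
  T U W : ℕ → ℚ
  T j = (sign j * ℕ→ℚ (suc N C j)) * g (suc i ∸ j)
  U j = (sign j * ℕ→ℚ (N C j)) * g (suc i ∸ j)
  W j = (sign j * ℕ→ℚ (N C j)) * g (i ∸ j)
  pascal : ∀ j → T (suc j) ≡ U (suc j) - W j
  pascal j = begin
    (- sign j * ℕ→ℚ (suc N C suc j)) * g (i ∸ j)
      ≡⟨ cong (λ c → (- sign j * c) * g (i ∸ j))
           (trans (cong ℕ→ℚ (sym (nCk+nC[k+1]≡[n+1]C[k+1] N j))) (ℕ→ℚ-+ (N C j) (N C suc j))) ⟩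
    (- sign j * (ℕ→ℚ (N C j) + ℕ→ℚ (N C suc j))) * g (i ∸ j)
      ≡⟨ solve 4 (λ s c c′ x → (:- s :* (c :+ c′)) :* x := (:- s :* c′) :* x :- (s :* c) :* x) refl
           (sign j) (ℕ→ℚ (N C j)) (ℕ→ℚ (N C suc j)) (g (i ∸ j)) ⟩
    U (suc j) - W j ∎
    where open +-*-Solver using (:-_)

binomialDifference≗Δ^ : ∀ N g → binomialDifference N g ≗ Δ^ N g
binomialDifference≗Δ^ zero    g   = binomialDifference-zero g
binomialDifference≗Δ^ (suc N) g i = begin
  binomialDifference (suc N) g i ≡⟨ binomialDifference-suc N g i ⟩
  Δ (binomialDifference N g) i   ≡⟨ Δ-cong (binomialDifference≗Δ^ N g) i ⟩
  Δ (Δ^ N g) i                   ≡⟨ sym (Δ^-Δ N g i) ⟩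
  Δ^ (suc N) g i                 ∎

JS-above-diagonal : ∀ {n k} z → n ℕ.< k → JS n k z ≡ 0ℚ
JS-above-diagonal {zero}  {suc k} z _         = refl
JS-above-diagonal {suc n} {suc k} z (s≤s n<k) = begin
  JS n k z + w * JS n (suc k) z
    ≡⟨ cong₂ (λ u v → u + w * v) (JS-above-diagonal z n<k) (JS-above-diagonal z (ℕ.m<n⇒m<1+n n<k)) ⟩
  0ℚ + w * 0ℚ
    ≡⟨ cong (0ℚ +_) (ℚ.*-zeroʳ w) ⟩
  0ℚ ∎
  where w = ℕ→ℚ (suc k) * (ℕ→ℚ (suc k) + z)

JS-diagonal : ∀ n z → JS n n z ≡ 1ℚ
JS-diagonal zero    z = refl
JS-diagonal (suc n) z = begin
  JS n n z + w * JS n (suc n) z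
    ≡⟨ cong₂ (λ u v → u + w * v) (JS-diagonal n z) (JS-above-diagonal z (ℕ.n<1+n n)) ⟩
  1ℚ + w * 0ℚ
    ≡⟨ cong (1ℚ +_) (ℚ.*-zeroʳ w) ⟩
  1ℚ ∎
  where w = ℕ→ℚ (suc n) * (ℕ→ℚ (suc n) + z)

F : ℕ → ℚ → Seq
F k z n = JS (k +ℕ n) n z

jsWeighted : ℚ → Seq → Seq
jsWeighted z g n = (ℕ→ℚ n * (ℕ→ℚ n + z)) * g n

Δ-F : ∀ k z → Δ (F (suc k) z) ≗ jsWeighted z (F k z)
Δ-F k z zero    = sym (trans (cong (_* F k z zero) (ℚ.*-zeroˡ (0ℚ + z))) (ℚ.*-zeroˡ (F k z zero)))
Δ-F k z (suc n) = begin
  (JS (k +ℕ suc n) n z + jsWeighted z (F k z) (suc n)) - JS (suc k +ℕ n) n z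
    ≡⟨ cong (λ m → (JS m n z + jsWeighted z (F k z) (suc n)) - JS (suc k +ℕ n) n z) (ℕ.+-suc k n) ⟩
  (JS (suc k +ℕ n) n z + jsWeighted z (F k z) (suc n)) - JS (suc k +ℕ n) n z
    ≡⟨ solve 2 (λ u v → (u :+ v) :- u := v) refl
         (JS (suc k +ℕ n) n z) (jsWeighted z (F k z) (suc n)) ⟩
  jsWeighted z (F k z) (suc n) ∎

a≡Δ^F : ∀ k i z → a k i z ≡ Δ^ (3 *ℕ k +ℕ 1) (F k z) i
a≡Δ^F k i z = trans (sumℚ-map-applyUpTo (suc i) term (λ j → j))
                    (binomialDifference≗Δ^ (3 *ℕ k +ℕ 1) (F k z) i)
  where
  term : Seq
  term j = (sign j * ℕ→ℚ ((3 *ℕ k +ℕ 1) C j)) * F k z (i ∸ j)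

threeTerm : (Q z N x y w : ℚ) → ℚ
threeTerm Q z N x y w =
  (N * (N + z)) * x
  + ((ℕ→ℚ 2 * N) * ((Q - N) - 1ℚ) - (1ℚ - z) * (Q - ℕ→ℚ 2 * N)) * y
  + ((Q - N) * ((Q - N) - z)) * w

threeTermₚ : ∀ {m} (Q z N x y w : Polynomial m) → Polynomial m
threeTermₚ Q z N x y w =
  (N :* (N :+ z)) :* x
  :+ ((con (ℕ→ℚ 2) :* N) :* ((Q :- N) :- con 1ℚ) :- (con 1ℚ :- z) :* (Q :- con (ℕ→ℚ 2) :* N)) :* y
  :+ ((Q :- N) :* ((Q :- N) :- z)) :* w

threeTerm-Δ : ∀ Q z N x y w v →
  threeTerm Q z (1ℚ + N) x y w - threeTerm Q z N y w v
    ≡ threeTerm (1ℚ + Q) z (1ℚ + N) (x - y) (y - w) (w - v)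
threeTerm-Δ = solve 7 (λ Q z N x y w v →
  threeTermₚ Q z (con 1ℚ :+ N) x y w :- threeTermₚ Q z N y w v
    := threeTermₚ (con 1ℚ :+ Q) z (con 1ℚ :+ N) (x :- y) (y :- w) (w :- v)) refl

threeTerm-Q≡0 : ∀ z N x y w → threeTerm 0ℚ z N x y w ≡ (N * (N + z)) * ((x - y) - (y - w))
threeTerm-Q≡0 = solve 5 (λ z N x y w →
  threeTermₚ (con 0ℚ) z N x y w := (N :* (N :+ z)) :* ((x :- y) :- (y :- w))) refl

threeTerm-N≡0 : ∀ Q z x → threeTerm Q z 0ℚ x 0ℚ 0ℚ ≡ 0ℚ
threeTerm-N≡0 = solve 3 (λ Q z x → threeTermₚ Q z (con 0ℚ) x (con 0ℚ) (con 0ℚ) := con 0ℚ) refl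

threeTerm-zero : ∀ Q z N {x y w} → x ≡ 0ℚ → y ≡ 0ℚ → w ≡ 0ℚ → threeTerm Q z N x y w ≡ 0ℚ
threeTerm-zero Q z N refl refl refl =
  solve 3 (λ Q z N → threeTermₚ Q z N (con 0ℚ) (con 0ℚ) (con 0ℚ) := con 0ℚ) refl Q z N

threeTerm-nonnegForm : ∀ z J R x y w →
  threeTerm (ℕ→ℚ 2 + (J + R)) z (1ℚ + J) x y w
    ≡ ((1ℚ + J) * (J + (1ℚ + z))) * x
      + ((1ℚ + z) * ((1ℚ + J) * R) + (1ℚ - z) * (J * (1ℚ + R))) * y
      + ((1ℚ + R) * (R + (1ℚ - z))) * w
threeTerm-nonnegForm = solve 6 (λ z J R x y w →
  threeTermₚ (con (ℕ→ℚ 2) :+ (J :+ R)) z (con 1ℚ :+ J) x y w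
    := ((con 1ℚ :+ J) :* (J :+ (con 1ℚ :+ z))) :* x
       :+ ((con 1ℚ :+ z) :* ((con 1ℚ :+ J) :* R) :+ (con 1ℚ :- z) :* (J :* (con 1ℚ :+ R))) :* y
       :+ ((con 1ℚ :+ R) :* (R :+ (con 1ℚ :- z))) :* w) refl

threeTermSeq : ℕ → ℚ → Seq → Seq
threeTermSeq Q z h n = threeTerm (ℕ→ℚ Q) z (ℕ→ℚ n) (h n) (shift h n) (shift (shift h) n)

threeTermSeq-cong : ∀ Q z {g h} → g ≗ h → threeTermSeq Q z g ≗ threeTermSeq Q z h
threeTermSeq-cong Q z {g} {h} g≗h n =
  trans (cong (λ x → threeTerm (ℕ→ℚ Q) z (ℕ→ℚ n) x (shift g n) (shift (shift g) n)) (g≗h n))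
        (cong₂ (threeTerm (ℕ→ℚ Q) z (ℕ→ℚ n) (h n)) (shift-cong g≗h n) (shift-cong (shift-cong g≗h) n))

Δ-threeTermSeq : ∀ Q z h → Δ (threeTermSeq Q z h) ≗ threeTermSeq (suc Q) z (Δ h)
Δ-threeTermSeq Q z h zero =
  trans (cong (_- 0ℚ) (threeTerm-N≡0 (ℕ→ℚ Q) z (h zero)))
        (sym (threeTerm-N≡0 (ℕ→ℚ (suc Q)) z (Δ h zero)))
Δ-threeTermSeq Q z h (suc n) = begin
  threeTerm (ℕ→ℚ Q) z (ℕ→ℚ (suc n)) x y w - threeTerm (ℕ→ℚ Q) z (ℕ→ℚ n) y w v
    ≡⟨ cong (λ N → threeTerm (ℕ→ℚ Q) z N x y w - threeTerm (ℕ→ℚ Q) z (ℕ→ℚ n) y w v) (ℕ→ℚ-suc n) ⟩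
  threeTerm (ℕ→ℚ Q) z (1ℚ + ℕ→ℚ n) x y w - threeTerm (ℕ→ℚ Q) z (ℕ→ℚ n) y w v
    ≡⟨ threeTerm-Δ (ℕ→ℚ Q) z (ℕ→ℚ n) x y w v ⟩
  threeTerm (1ℚ + ℕ→ℚ Q) z (1ℚ + ℕ→ℚ n) (x - y) (y - w) (w - v)
    ≡⟨ cong₂ (λ Q′ N → threeTerm Q′ z N (x - y) (y - w) (w - v))
         (sym (ℕ→ℚ-suc Q)) (sym (ℕ→ℚ-suc n)) ⟩
  threeTerm (ℕ→ℚ (suc Q)) z (ℕ→ℚ (suc n)) (x - y) (y - w) (w - v)
    ≡⟨ cong (threeTerm (ℕ→ℚ (suc Q)) z (ℕ→ℚ (suc n)) (x - y) (y - w)) (sym (shift-Δ h n)) ⟩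
  threeTermSeq (suc Q) z (Δ h) (suc n) ∎
  where
  x = h (suc n)
  y = h n
  w = shift h n
  v = shift (shift h) n

Δ^-threeTermSeq : ∀ m Q z h → Δ^ m (threeTermSeq Q z h) ≗ threeTermSeq (Q +ℕ m) z (Δ^ m h)
Δ^-threeTermSeq zero    Q z h n = cong (λ Q′ → threeTermSeq Q′ z h n) (sym (ℕ.+-identityʳ Q))
Δ^-threeTermSeq (suc m) Q z h n = begin
  Δ^ m (Δ (threeTermSeq Q z h)) n
    ≡⟨ Δ^-cong m (Δ-threeTermSeq Q z h) n ⟩
  Δ^ m (threeTermSeq (suc Q) z (Δ h)) n
    ≡⟨ Δ^-threeTermSeq m (suc Q) z (Δ h) n ⟩
  threeTermSeq (suc Q +ℕ m) z (Δ^ m (Δ h)) n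
    ≡⟨ cong (λ Q′ → threeTermSeq Q′ z (Δ^ m (Δ h)) n) (sym (ℕ.+-suc Q m)) ⟩
  threeTermSeq (Q +ℕ suc m) z (Δ^ (suc m) h) n ∎

jsWeighted-Δ² : ∀ z h → jsWeighted z (Δ (Δ h)) ≗ threeTermSeq 0 z h
jsWeighted-Δ² z h n = begin
  (N * (N + z)) * ((h n - shift h n) - shift (Δ h) n)
    ≡⟨ cong (λ t → (N * (N + z)) * ((h n - shift h n) - t)) (shift-Δ h n) ⟩
  (N * (N + z)) * ((h n - shift h n) - (shift h n - shift (shift h) n))
    ≡⟨ sym (threeTerm-Q≡0 z N (h n) (shift h n) (shift (shift h) n)) ⟩
  threeTermSeq 0 z h n ∎
  where N = ℕ→ℚ n

Δ^-jsWeighted : ∀ m z g → Δ^ (2 +ℕ m) (jsWeighted z g) ≗ threeTermSeq (2 +ℕ m) z (Δ^ m g)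
Δ^-jsWeighted m z g n = begin
  Δ^ (2 +ℕ m) (jsWeighted z g) n
    ≡⟨ Δ^-cong (2 +ℕ m) (λ j → cong (ℕ→ℚ j * (ℕ→ℚ j + z) *_) (sym (Δ²H≗g j))) n ⟩
  Δ^ (2 +ℕ m) (jsWeighted z (Δ (Δ H))) n
    ≡⟨ Δ^-cong (2 +ℕ m) (jsWeighted-Δ² z H) n ⟩
  Δ^ (2 +ℕ m) (threeTermSeq 0 z H) n
    ≡⟨ Δ^-threeTermSeq (2 +ℕ m) 0 z H n ⟩
  threeTermSeq (2 +ℕ m) z (Δ^ m (Δ (Δ H))) n
    ≡⟨ threeTermSeq-cong (2 +ℕ m) z (Δ^-cong m Δ²H≗g) n ⟩
  threeTermSeq (2 +ℕ m) z (Δ^ m g) n ∎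
  where
  H = prefixSum (prefixSum g)
  Δ²H≗g : Δ (Δ H) ≗ g
  Δ²H≗g j = trans (Δ-cong (Δ-prefixSum (prefixSum g)) j) (Δ-prefixSum g j)

a-recurrence : ∀ k i z → a (suc k) i z ≡ threeTermSeq (3 *ℕ suc k) z (λ j → a k j z) i
a-recurrence k i z = begin
  a (suc k) i z
    ≡⟨ a≡Δ^F (suc k) i z ⟩
  Δ^ (3 *ℕ suc k +ℕ 1) (F (suc k) z) i
    ≡⟨ cong (λ m → Δ^ m (F (suc k) z) i) (ℕ.+-comm (3 *ℕ suc k) 1) ⟩
  Δ^ (3 *ℕ suc k) (Δ (F (suc k) z)) i
    ≡⟨ Δ^-cong (3 *ℕ suc k) (Δ-F k z) i ⟩
  Δ^ (3 *ℕ suc k) (jsWeighted z (F k z)) i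
    ≡⟨ subst (λ Q → Δ^ Q (jsWeighted z (F k z)) i ≡ threeTermSeq Q z (Δ^ m (F k z)) i)
         (2+[3k+1]≡3[1+k] k) (Δ^-jsWeighted m z (F k z) i) ⟩
  threeTermSeq (3 *ℕ suc k) z (Δ^ m (F k z)) i
    ≡⟨ threeTermSeq-cong (3 *ℕ suc k) z (λ j → sym (a≡Δ^F k j z)) i ⟩
  threeTermSeq (3 *ℕ suc k) z (λ j → a k j z) i ∎
  where
  m = 3 *ℕ k +ℕ 1
  2+[3k+1]≡3[1+k] : ∀ k → 2 +ℕ (3 *ℕ k +ℕ 1) ≡ 3 *ℕ suc k
  2+[3k+1]≡3[1+k] = solve-∀

a-zero : ∀ i z → a 0 i z ≡ δ0 i
a-zero zero    z = a≡Δ^F 0 0 z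
a-zero (suc i) z = begin
  a 0 (suc i) z                    ≡⟨ a≡Δ^F 0 (suc i) z ⟩
  JS (suc i) (suc i) z - JS i i z  ≡⟨ cong₂ _-_ (JS-diagonal (suc i) z) (JS-diagonal i z) ⟩
  1ℚ - 1ℚ                          ≡⟨⟩
  0ℚ                               ∎

+-nonneg : ∀ {p q} → 0ℚ ≤ p → 0ℚ ≤ q → 0ℚ ≤ p + q
+-nonneg = ℚ.+-mono-≤

*-nonneg : ∀ {p q} → 0ℚ ≤ p → 0ℚ ≤ q → 0ℚ ≤ p * q
*-nonneg {p} {q} 0≤p 0≤q =
  ℚ.nonNegative⁻¹ _ {{ℚ.nonNeg*nonNeg⇒nonNeg p {{nonNegative 0≤p}} q {{nonNegative 0≤q}}}}

ℕ→ℚ-nonneg : ∀ n → 0ℚ ≤ ℕ→ℚ n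
ℕ→ℚ-nonneg n = ℚ.nonNegative⁻¹ _ {{ℚ.normalize-nonNeg n 1}}

threeTerm-nonneg : ∀ {z J R x y w} → - 1ℚ < z → z < 1ℚ → 0ℚ ≤ J → 0ℚ ≤ R →
  0ℚ ≤ x → 0ℚ ≤ y → 0ℚ ≤ w → 0ℚ ≤ threeTerm (ℕ→ℚ 2 + (J + R)) z (1ℚ + J) x y w
threeTerm-nonneg {z} {J} {R} {x} {y} {w} -1<z z<1 0≤J 0≤R 0≤x 0≤y 0≤w =
  subst (0ℚ ≤_) (sym (threeTerm-nonnegForm z J R x y w))
    (+-nonneg (+-nonneg (*-nonneg 0≤c₀ 0≤x) (*-nonneg 0≤c₁ 0≤y)) (*-nonneg 0≤c₂ 0≤w))
  where
  0≤1+z : 0ℚ ≤ 1ℚ + z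
  0≤1+z = ℚ.<⇒≤ (ℚ.+-monoʳ-< 1ℚ -1<z)
  0≤1-z : 0ℚ ≤ 1ℚ - z
  0≤1-z = ℚ.<⇒≤ (subst (_< 1ℚ - z) (ℚ.+-inverseʳ z) (ℚ.+-monoˡ-< (- z) z<1))
  0≤1+J : 0ℚ ≤ 1ℚ + J
  0≤1+J = +-nonneg (ℕ→ℚ-nonneg 1) 0≤J
  0≤1+R : 0ℚ ≤ 1ℚ + R
  0≤1+R = +-nonneg (ℕ→ℚ-nonneg 1) 0≤R
  0≤c₀ : 0ℚ ≤ (1ℚ + J) * (J + (1ℚ + z))
  0≤c₀ = *-nonneg 0≤1+J (+-nonneg 0≤J 0≤1+z)
  0≤c₁ : 0ℚ ≤ (1ℚ + z) * ((1ℚ + J) * R) + (1ℚ - z) * (J * (1ℚ + R))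
  0≤c₁ = +-nonneg (*-nonneg 0≤1+z (*-nonneg 0≤1+J 0≤R)) (*-nonneg 0≤1-z (*-nonneg 0≤J 0≤1+R))
  0≤c₂ : 0ℚ ≤ (1ℚ + R) * (R + (1ℚ - z))
  0≤c₂ = *-nonneg 0≤1+R (+-nonneg 0≤R 0≤1-z)

shift-nonneg : ∀ {h} → (∀ n → 0ℚ ≤ h n) → ∀ n → 0ℚ ≤ shift h n
shift-nonneg 0≤h zero    = ℚ.≤-refl
shift-nonneg 0≤h (suc n) = 0≤h n

threeTermSeq-nonneg-below : ∀ {Q z h} → - 1ℚ < z → z < 1ℚ → (∀ n → 0ℚ ≤ h n) →
  ∀ n → n ℕ.< Q → 0ℚ ≤ threeTermSeq Q z h n
threeTermSeq-nonneg-below {Q} {z} {h} _ _ _ zero _ =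
  ℚ.≤-reflexive (sym (threeTerm-N≡0 (ℕ→ℚ Q) z (h zero)))
threeTermSeq-nonneg-below {Q} {z} {h} -1<z z<1 0≤h (suc j) 2+j≤Q =
  subst₂ (λ Q′ N → 0ℚ ≤ threeTerm Q′ z N (h (suc j)) (h j) (shift h j))
    (sym Q≡2+j+r) (sym (ℕ→ℚ-suc j))
    (threeTerm-nonneg -1<z z<1 (ℕ→ℚ-nonneg j) (ℕ→ℚ-nonneg r)
       (0≤h (suc j)) (0≤h j) (shift-nonneg 0≤h j))
  where
  r = Q ∸ (2 +ℕ j)
  Q≡2+j+r : ℕ→ℚ Q ≡ ℕ→ℚ 2 + (ℕ→ℚ j + ℕ→ℚ r)
  Q≡2+j+r = begin
    ℕ→ℚ Q                         ≡⟨ cong ℕ→ℚ (sym (ℕ.m+[n∸m]≡n 2+j≤Q)) ⟩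
    ℕ→ℚ (2 +ℕ (j +ℕ r))           ≡⟨ ℕ→ℚ-+ 2 (j +ℕ r) ⟩
    ℕ→ℚ 2 + ℕ→ℚ (j +ℕ r)          ≡⟨ cong (ℕ→ℚ 2 +_) (ℕ→ℚ-+ j r) ⟩
    ℕ→ℚ 2 + (ℕ→ℚ j + ℕ→ℚ r)       ∎

VanishesAbove : ℕ → Seq → Set
VanishesAbove d h = ∀ n → d ℕ.< n → h n ≡ 0ℚ

threeTermSeq-vanishesAbove : ∀ Q z {d h} →
  VanishesAbove d h → VanishesAbove (2 +ℕ d) (threeTermSeq Q z h)
threeTermSeq-vanishesAbove Q z {h = h} h≡0 (suc (suc n)) (s≤s (s≤s d<n)) =
  threeTerm-zero (ℕ→ℚ Q) z (ℕ→ℚ (suc (suc n)))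
    (h≡0 (suc (suc n)) (ℕ.m<n⇒m<1+n (ℕ.m<n⇒m<1+n d<n))) (h≡0 (suc n) (ℕ.m<n⇒m<1+n d<n)) (h≡0 n d<n)

threeTermSeq-nonneg : ∀ {d Q z h} → - 1ℚ < z → z < 1ℚ → (∀ n → 0ℚ ≤ h n) → VanishesAbove d h →
  2 +ℕ d ℕ.< Q → ∀ n → 0ℚ ≤ threeTermSeq Q z h n
threeTermSeq-nonneg {Q = Q} {z} -1<z z<1 0≤h h≡0 2+d<Q n with n ℕ.<? Q
... | yes n<Q = threeTermSeq-nonneg-below -1<z z<1 0≤h n n<Q
... | no  n≮Q =
  ℚ.≤-reflexive (sym (threeTermSeq-vanishesAbove Q z h≡0 n (ℕ.<-≤-trans 2+d<Q (ℕ.≮⇒≥ n≮Q))))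

a-nonneg-vanishesAbove : ∀ {z} → - 1ℚ < z → z < 1ℚ →
  ∀ k → (∀ i → 0ℚ ≤ a k i z) × VanishesAbove (2 *ℕ k) (λ i → a k i z)
a-nonneg-vanishesAbove {z} _ _ zero = 0≤a₀ , a₀≡0
  where
  0≤δ0 : ∀ i → 0ℚ ≤ δ0 i
  0≤δ0 zero    = ℕ→ℚ-nonneg 1
  0≤δ0 (suc i) = ℚ.≤-refl
  0≤a₀ : ∀ i → 0ℚ ≤ a 0 i z
  0≤a₀ i = subst (0ℚ ≤_) (sym (a-zero i z)) (0≤δ0 i)
  a₀≡0 : VanishesAbove 0 (λ i → a 0 i z)
  a₀≡0 (suc i) _ = a-zero (suc i) z
a-nonneg-vanishesAbove {z} -1<z z<1 (suc k) = 0≤a′ , a′≡0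
  where
  0≤a = proj₁ (a-nonneg-vanishesAbove -1<z z<1 k)
  a≡0 = proj₂ (a-nonneg-vanishesAbove -1<z z<1 k)
  2+2k<3[1+k] : 2 +ℕ 2 *ℕ k ℕ.< 3 *ℕ suc k
  2+2k<3[1+k] = subst (2 +ℕ 2 *ℕ k ℕ.<_) (sym (ℕ.*-suc 3 k))
    (ℕ.+-mono-<-≤ (ℕ.n<1+n 2) (ℕ.*-monoˡ-≤ k (ℕ.n≤1+n 2)))
  0≤a′ : ∀ i → 0ℚ ≤ a (suc k) i z
  0≤a′ i = subst (0ℚ ≤_) (sym (a-recurrence k i z))
    (threeTermSeq-nonneg -1<z z<1 0≤a a≡0 2+2k<3[1+k] i)
  a′≡0 : VanishesAbove (2 *ℕ suc k) (λ i → a (suc k) i z)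
  a′≡0 i 2+2k<i = trans (a-recurrence k i z)
    (threeTermSeq-vanishesAbove (3 *ℕ suc k) z a≡0 i (subst (ℕ._< i) (ℕ.*-suc 2 k) 2+2k<i))

aShift-suc : ∀ k i d z → aShift k i (suc d) z ≡ shift (λ j → aShift k j d z) i
aShift-suc k zero    d z = refl
aShift-suc k (suc i) d z = refl

proposition2p3 :
    ((i : ℕ) (z : ℚ) → a 0 i z ≡ δ0 i)
    × ((k i : ℕ) (z : ℚ) → z ≢ 1ℚ →
        a (suc k) i z
          ≡ (ℕ→ℚ i * (ℕ→ℚ i + z)) * aShift k i 0 z
            + ((ℕ→ℚ 2 * ℕ→ℚ i) * ((ℕ→ℚ (3 *ℕ suc k) - ℕ→ℚ i) - 1ℚ)
                - (1ℚ - z) * (ℕ→ℚ (3 *ℕ suc k) - ℕ→ℚ 2 * ℕ→ℚ i)) * aShift k i 1 z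
            + ((ℕ→ℚ (3 *ℕ suc k) - ℕ→ℚ i) * ((ℕ→ℚ (3 *ℕ suc k) - ℕ→ℚ i) - z)) * aShift k i 2 z)
    × ((k i : ℕ) (z : ℚ) → 1 ≤ℕ k → 1 ≤ℕ i → i ≤ℕ 2 *ℕ k →
        - 1ℚ < z → z < 1ℚ → 0ℚ ≤ a k i z)
proposition2p3 =
  a-zero
  , (λ k i z _ → trans (a-recurrence k i z)
       (cong₂ (threeTerm (ℕ→ℚ (3 *ℕ suc k)) z (ℕ→ℚ i) (a k i z))
         (sym (aShift-suc k i 0 z))
         (trans (shift-cong (λ j → sym (aShift-suc k j 0 z)) i) (sym (aShift-suc k i 1 z)))))
  , (λ k i z _ _ _ -1<z z<1 → proj₁ (a-nonneg-vanishesAbove -1<z z<1 k) i)
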